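{- Let $p\geq1$ and let $(a_n^{(k)})_{n\in\mathbb{Z}}$, $0\leq k\leq p$, be bi-infinite sequences of complex numbers. With the resolvent series defined in the context, the following identities hold in $\mathbb{C}((z^{ -1}))$. For every integer $k\geq0$, \[ \phi_{0}^{(k)}(z)=\frac{1}{z-a_{k}^{(0)}-\sum_{j=1}^{p}a_{k}^{(j)}\,\phi_{j-1}^{(k+1)}(z)},\qquad \phi_{j}^{(k)}(z)=\phi_{0}^{(k)}(z)\,\phi^{(k+1)}_{j-1}(z)\quad(1\leq j\leq p). \] Moreover, \[ \psi_{0}(z)=\frac{1}{z-a_{0}^{(0)}-\sum_{j=1}^{p}\sum_{k=0}^{j}a_{ -k}^{(j)}\,\phi_{j-k-1}^{(1)}(z)\,\beta_{k-1}^{(1)}(z)},\qquad \psi_{j}(z)=\psi_{0}(z)\,\phi_{j-1}^{(1)}(z)\quad(1\leq j\leq p), \] where $\phi_{ -1}^{(1)}(z)\equiv\beta_{ -1}^{(1)}(z)\equiv 1$.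
   Context: $\mathbb{C}((z^{ -1}))$ denotes the field of formal series $\sum_{n\in\mathbb{Z}} c_n z^{ -n}$ with only finitely many nonzero $c_n$, $n<0$. Let $\{e_j\}_{j\geq0}$ be the standard basis of $\ell^2(\mathbb{Z}_{\geq0})$ and $D_0$ its linear span; let $\{\hat e_n\}_{n\in\mathbb{Z}}$ be the standard basis of $\ell^2(\mathbb{Z})$ and $D_1$ its linear span. For an integer $q\geq0$, define linear maps $\mathcal{H}_q,\mathcal{B}_q:D_0\to D_0$ by $\mathcal{H}_qe_0=\sum_{k=0}^pa_q^{(k)}e_k$, $\mathcal{H}_qe_n=e_{n-1}+\sum_{k=0}^pa_{n+q}^{(k)}e_{n+k}$ ($n\geq1$); $\mathcal{B}_qe_0=\sum_{k=0}^pa_{ -k-q}^{(k)}e_k$, $\mathcal{B}_qe_n=e_{n-1}+\sum_{k=0}^pa_{ -k-q-n}^{(k)}e_{n+k}$ ($n\geq1$); and $\mathcal{W}:D_1\to D_1$ by $\mathcal{W}\hat e_n=\hat e_{n-1}+\sum_{k=0}^pa_n^{(k)}\hat e_{n+k}$, $n\in\mathbb{Z}$. For $0\leq j\leq p$ define the formal series $\phi_j^{(q)}(z)=\sum_{n\ge0}\langle\mathcal{H}_q^ne_j,e_0\rangle z^{ -n-1}$, $\beta_j^{(q)}(z)=\sum_{n\ge0}\langle\mathcal{B}_q^ne_j,e_0\rangle z^{ -n-1}$, $\psi_j(z)=\sum_{n\ge0}\langle\mathcal{W}^n\hat e_j,\hat e_0\rangle z^{ -n-1}$. -}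

module Defs where

open import Level using (Level)
open import Algebra.Bundles using (CommutativeRing)
open import Data.Nat as ℕ using (ℕ; zero; suc; _∸_; _⊔_)
open import Data.Integer as ℤ using (ℤ; +_; -[1+_])
open import Data.Bool using (Bool; true; false; if_then_else_)
open import Relation.Nullary.Decidable using (⌊_⌋)

pow : ∀ {a} {X : Set a} → ℕ → (X → X) → X → X
pow zero    f x = x
pow (suc n) f x = f (pow n f x)

module Series {c ℓ : Level} (R : CommutativeRing c ℓ) where
  open CommutativeRing R renaming (Carrier to A)

  Σ< : ℕ → (ℕ → A) → A
  Σ< zero    f = 0#
  Σ< (suc n) f = Σ< n f + f n

  -- Formal Laurent series in z^{-1}:  laurent t f  represents
  --   Σ_{m ≥ 0} f m · z^(t - m)   (only finitely many positive powers)
  record Laurent : Set c where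
    constructor laurent
    field
      top : ℕ
      cf  : ℕ → A
  open Laurent public

  coeff : Laurent → ℤ → A
  coeff s e with (+ top s) ℤ.- e
  ... | + m      = cf s m
  ... | -[1+ _ ] = 0#

  infix 4 _≈L_
  _≈L_ : Laurent → Laurent → Set ℓ
  s ≈L t = ∀ (e : ℤ) → coeff s e ≈ coeff t e

  infixl 6 _+L_ _-L_
  infixl 7 _*L_

  _+L_ : Laurent → Laurent → Laurent
  s +L t = laurent T (λ m → coeff s (+ T ℤ.- + m) + coeff t (+ T ℤ.- + m))
    where T = top s ⊔ top t

  -L_ : Laurent → Laurent
  -L s = laurent (top s) (λ m → - cf s m)

  _-L_ : Laurent → Laurent → Laurent
  s -L t = s +L (-L t)

  _*L_ : Laurent → Laurent → Laurent
  s *L t = laurent (top s ℕ.+ top t)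
                   (λ m → Σ< (suc m) (λ i → cf s i * cf t (m ∸ i)))

  const : A → Laurent
  const a = laurent 0 (λ { zero → a ; (suc _) → 0# })

  oneL : Laurent
  oneL = const 1#

  zL : Laurent
  zL = laurent 1 (λ { zero → 1# ; (suc _) → 0# })

  ΣL< : ℕ → (ℕ → Laurent) → Laurent
  ΣL< zero    f = const 0#
  ΣL< (suc n) f = ΣL< n f +L f n

  -- the series Σ_{n≥0} s n · z^{-n-1}
  resolvent : (ℕ → A) → Laurent
  resolvent s = laurent 0 (λ { zero → 0# ; (suc n) → s n })

  -- Operators, written in coordinates on finitely supported vectors.
  -- a k n  stands for  a_n^{(k)}  (only 0 ≤ k ≤ p is ever used).

  e : ℕ → (ℕ → A)
  e j m = if j ℕ.≡ᵇ m then 1# else 0#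

  ê : ℤ → (ℤ → A)
  ê j m = if ⌊ j ℤ.≟ m ⌋ then 1# else 0#

  -- H_q e_n = e_{n-1} + Σ_k a_{n+q}^{(k)} e_{n+k}   (no e_{-1} term for n = 0)
  opH : ℕ → (ℕ → ℤ → A) → ℕ → (ℕ → A) → (ℕ → A)
  opH p a q v m = v (suc m) +
    Σ< (suc p) (λ k → if k ℕ.≤ᵇ m
                      then a k (+ (m ∸ k) ℤ.+ + q) * v (m ∸ k)
                      else 0#)

  -- B_q e_n = e_{n-1} + Σ_k a_{-k-q-n}^{(k)} e_{n+k}
  opB : ℕ → (ℕ → ℤ → A) → ℕ → (ℕ → A) → (ℕ → A)
  opB p a q v m = v (suc m) +
    Σ< (suc p) (λ k → if k ℕ.≤ᵇ m
                      then a k (ℤ.- + k ℤ.- + q ℤ.- + (m ∸ k)) * v (m ∸ k)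
                      else 0#)

  -- W ê_n = ê_{n-1} + Σ_k a_n^{(k)} ê_{n+k}
  opW : ℕ → (ℕ → ℤ → A) → (ℤ → A) → (ℤ → A)
  opW p a v m = v (m ℤ.+ + 1) +
    Σ< (suc p) (λ k → a k (m ℤ.- + k) * v (m ℤ.- + k))

  -- resolvent series; ⟨x, e_0⟩ = x_0
  φ : ℕ → (ℕ → ℤ → A) → ℕ → ℕ → Laurent
  φ p a q j = resolvent (λ n → pow n (opH p a q) (e j) 0)

  β : ℕ → (ℕ → ℤ → A) → ℕ → ℕ → Laurent
  β p a q j = resolvent (λ n → pow n (opB p a q) (e j) 0)

  ψ : ℕ → (ℕ → ℤ → A) → ℕ → Laurent
  ψ p a j = resolvent (λ n → pow n (opW p a) (ê (+ j)) (+ 0))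

  -- shifted index with the convention  φ_{-1} ≡ β_{-1} ≡ 1:
  --   φ↑ p a q i = φ^{(q)}_{i-1}
  φ↑ : ℕ → (ℕ → ℤ → A) → ℕ → ℕ → Laurent
  φ↑ p a q zero    = oneL
  φ↑ p a q (suc i) = φ p a q i

  β↑ : ℕ → (ℕ → ℤ → A) → ℕ → ℕ → Laurent
  β↑ p a q zero    = oneL
  β↑ p a q (suc i) = β p a q i

-- ⟨Hⁿ e_j, e₀⟩ is a sum over weighted walks from e_j to e₀, and products of resolvents are
-- convolutions of their coefficient sequences. Cutting a walk from e_{j+1} at its first visit
-- to e₀ (a discrete Duhamel formula: on e₁, e₂, … the operator H_q is a shifted copy of
-- H_{q+1}) gives φ_{j+1}^{(q)} = φ_0^{(q)} φ_j^{(q+1)}; cutting a walk from e₀ after its first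
-- step gives the recurrence saying that φ_0^{(q)} inverts z - a_q^{(0)} - Σ_j a_q^{(j)} φ_{j-1}^{(q+1)}.
-- For W the nonnegative half-line behaves like H₁, while a first step to ê_{-1} starts a walk of
-- B₁ on the negative half-line, which re-enters at one of ê₀, …, ê_{p-1}; these re-entries
-- produce the β-terms of the denominator of ψ₀.
module Submission where

open import Defs
open import Level using (Level; _⊔_)
open import Algebra.Bundles using (CommutativeRing)
import Algebra.Properties.CommutativeSemigroup as CommutativeSemigroupProperties
import Algebra.Properties.Ring as RingProperties
open import Data.Bool using (Bool; true; false; if_then_else_)
open import Data.Empty using (⊥-elim)
open import Data.Integer as ℤ using (ℤ; +_; -[1+_])
import Data.Integer.Properties as ℤ
open import Data.Integer.Tactic.RingSolver using (solve-∀)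
open import Data.Nat as ℕ using (ℕ; zero; suc; _∸_; _≤_; _<_; z≤n; s≤s)
import Data.Nat.Properties as ℕ
open import Data.Product using (_×_; _,_; ∃)
open import Data.Sum using (_⊎_; inj₁; inj₂)
open import Relation.Binary.PropositionalEquality as ≡ using (_≡_; _≢_)
open import Relation.Nullary using (¬_; yes; no)
open import Relation.Nullary.Decidable using (dec-true; dec-false; isYes≗does)

x-[x-y]≡y : ∀ x y → x ℤ.- (x ℤ.- y) ≡ y
x-[x-y]≡y = solve-∀

+m-+n≡+[m∸n] : ∀ {m n} → n ≤ m → + m ℤ.- + n ≡ + (m ∸ n)
+m-+n≡+[m∸n] {m} {n} n≤m = ≡.trans (ℤ.m-n≡m⊖n m n) (ℤ.⊖-≥ n≤m)

+m-+n≡-[n∸m] : ∀ {m n} → m ≤ n → + m ℤ.- + n ≡ ℤ.- + (n ∸ m)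
+m-+n≡-[n∸m] {m} {n} m≤n = ≡.trans (ℤ.m-n≡m⊖n m n) (ℤ.⊖-≤ m≤n)

above-or-below : ∀ B e → (+ B ℤ.< e) ⊎ ∃ (λ n → e ≡ + B ℤ.- + n)
above-or-below B e with + B ℤ.- e in eq
... | + n      = inj₂ (n , e≡B-[B-e])
  where
  e≡B-[B-e] : e ≡ + B ℤ.- + n
  e≡B-[B-e] = ≡.trans (≡.sym (x-[x-y]≡y (+ B) e)) (≡.cong (λ d → + B ℤ.- d) eq)
... | -[1+ k ] = inj₁ (≡.subst (+ B ℤ.<_) e≡ (ℤ.+<+ (ℕ.m<m+n B (s≤s z≤n))))
  where
  e≡ : + B ℤ.- -[1+ k ] ≡ e
  e≡ = ≡.trans (≡.cong (λ d → + B ℤ.- d) (≡.sym eq)) (x-[x-y]≡y (+ B) e)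

1-[1+n]≡0-n : ∀ n → + 1 ℤ.- + suc n ≡ + 0 ℤ.- + n
1-[1+n]≡0-n n = lemma (+ n)
  where
  lemma : ∀ x → + 1 ℤ.- (+ 1 ℤ.+ x) ≡ + 0 ℤ.- x
  lemma = solve-∀

-[1+i]-k≡-k-1-i : ∀ i k → -[1+ i ] ℤ.- + k ≡ ℤ.- + k ℤ.- + 1 ℤ.- + i
-[1+i]-k≡-k-1-i i k = lemma (+ i) (+ k)
  where
  lemma : ∀ x y → ℤ.- (+ 1 ℤ.+ x) ℤ.- y ≡ ℤ.- y ℤ.- + 1 ℤ.- x
  lemma = solve-∀

[i∸k]-[1+i]≡-[1+k] : ∀ {i k} → k ≤ i → + (i ∸ k) ℤ.- + suc i ≡ -[1+ k ]
[i∸k]-[1+i]≡-[1+k] {i} {k} k≤i = ≡.trans (+m-+n≡-[n∸m] (ℕ.≤-trans (ℕ.m∸n≤m i k) (ℕ.n≤1+n i)))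
  (≡.cong (λ d → ℤ.- + d) (≡.trans (ℕ.+-∸-assoc 1 (ℕ.m∸n≤m i k)) (≡.cong suc (ℕ.m∸[m∸n]≡n k≤i))))

module ResolventIdentities {c ℓ : Level} (R : CommutativeRing c ℓ) where
  open CommutativeRing R renaming (Carrier to A) hiding (zero)
  open RingProperties ring using (-0#≈0#; -‿+-comm; -‿distribʳ-*)
  open CommutativeSemigroupProperties +-commutativeSemigroup using (interchange)
  open CommutativeSemigroupProperties *-commutativeSemigroup using (x∙yz≈y∙xz)
  open import Relation.Binary.Reasoning.Setoid setoid
  open Series R

  infix 4 _≋_
  _≋_ : ∀ {I : Set} → (I → A) → (I → A) → Set ℓ
  v ≋ w = ∀ x → v x ≈ w x

  -- Finite sums

  Σ<-cong : ∀ n {f g : ℕ → A} → f ≋ g → Σ< n f ≈ Σ< n g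
  Σ<-cong zero    f≋g = refl
  Σ<-cong (suc n) f≋g = +-cong (Σ<-cong n f≋g) (f≋g n)

  Σ<-cong-< : ∀ n {f g : ℕ → A} → (∀ i → i < n → f i ≈ g i) → Σ< n f ≈ Σ< n g
  Σ<-cong-< zero    f≈g = refl
  Σ<-cong-< (suc n) f≈g =
    +-cong (Σ<-cong-< n (λ i i<n → f≈g i (ℕ.m<n⇒m<1+n i<n))) (f≈g n (ℕ.n<1+n n))

  Σ<-zero : ∀ n {f : ℕ → A} → (∀ i → f i ≈ 0#) → Σ< n f ≈ 0#
  Σ<-zero zero    f≈0 = refl
  Σ<-zero (suc n) f≈0 = trans (+-cong (Σ<-zero n f≈0) (f≈0 n)) (+-identityʳ 0#)

  Σ<-distrib-+ : ∀ n (f g : ℕ → A) → Σ< n (λ i → f i + g i) ≈ Σ< n f + Σ< n g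
  Σ<-distrib-+ zero    f g = sym (+-identityʳ 0#)
  Σ<-distrib-+ (suc n) f g =
    trans (+-congʳ (Σ<-distrib-+ n f g)) (interchange (Σ< n f) (Σ< n g) (f n) (g n))

  *-distribˡ-Σ< : ∀ n x (f : ℕ → A) → x * Σ< n f ≈ Σ< n (λ i → x * f i)
  *-distribˡ-Σ< zero    x f = zeroʳ x
  *-distribˡ-Σ< (suc n) x f = trans (distribˡ x (Σ< n f) (f n)) (+-congʳ (*-distribˡ-Σ< n x f))

  -‿distrib-Σ< : ∀ n (f : ℕ → A) → - Σ< n f ≈ Σ< n (λ i → - f i)
  -‿distrib-Σ< zero    f = -0#≈0#
  -‿distrib-Σ< (suc n) f = trans (sym (-‿+-comm (Σ< n f) (f n))) (+-congʳ (-‿distrib-Σ< n f))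

  Σ<-suc : ∀ n (f : ℕ → A) → Σ< (suc n) f ≈ f 0 + Σ< n (λ i → f (suc i))
  Σ<-suc zero    f = trans (+-identityˡ (f 0)) (sym (+-identityʳ (f 0)))
  Σ<-suc (suc n) f = trans (+-congʳ (Σ<-suc n f)) (+-assoc _ _ _)

  Σ<-comm : ∀ n m (f : ℕ → ℕ → A) →
            Σ< n (λ i → Σ< m (λ j → f i j)) ≈ Σ< m (λ j → Σ< n (λ i → f i j))
  Σ<-comm zero    m f = sym (Σ<-zero m (λ _ → refl))
  Σ<-comm (suc n) m f = trans (+-congʳ (Σ<-comm n m f)) (sym (Σ<-distrib-+ m _ _))

  Σ<-reverse : ∀ n (f : ℕ → A) → Σ< (suc n) (λ k → f (n ∸ k)) ≈ Σ< (suc n) f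
  Σ<-reverse zero    f = refl
  Σ<-reverse (suc n) f = begin
    Σ< (suc n) (λ k → f (suc n ∸ k)) + f (n ∸ n)
      ≈⟨ +-cong (Σ<-cong-< (suc n) (λ k k<1+n → reflexive (≡.cong f (ℕ.+-∸-assoc 1 (ℕ.≤-pred k<1+n)))))
                (reflexive (≡.cong f (ℕ.n∸n≡0 n))) ⟩
    Σ< (suc n) (λ k → f (suc (n ∸ k))) + f 0
      ≈⟨ +-comm _ _ ⟩
    f 0 + Σ< (suc n) (λ k → f (suc (n ∸ k)))
      ≈⟨ +-congˡ (Σ<-reverse n (λ i → f (suc i))) ⟩
    f 0 + Σ< (suc n) (λ k → f (suc k))
      ≈⟨ sym (Σ<-suc (suc n) f) ⟩
    Σ< (suc (suc n)) f ∎

  Σ<-truncate : ∀ {m n} (f : ℕ → A) → m ≤ n → (∀ i → m ≤ i → f i ≈ 0#) → Σ< n f ≈ Σ< m f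
  Σ<-truncate {m} {n} f m≤n f≈0 with ℕ.m≤n⇒∃[o]m+o≡n m≤n
  ... | d , ≡.refl = go d
    where
    go : ∀ d → Σ< (m ℕ.+ d) f ≈ Σ< m f
    go zero    = reflexive (≡.cong (λ k → Σ< k f) (ℕ.+-identityʳ m))
    go (suc d) = begin
      Σ< (m ℕ.+ suc d) f            ≡⟨ ≡.cong (λ k → Σ< k f) (ℕ.+-suc m d) ⟩
      Σ< (m ℕ.+ d) f + f (m ℕ.+ d)  ≈⟨ +-cong (go d) (f≈0 _ (ℕ.m≤m+n m d)) ⟩
      Σ< m f + 0#                   ≈⟨ +-identityʳ _ ⟩
      Σ< m f                        ∎

  -- Cauchy convolution

  infixl 7 _⋆_
  _⋆_ : (ℕ → A) → (ℕ → A) → ℕ → A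
  (f ⋆ g) n = Σ< (suc n) (λ i → f i * g (n ∸ i))

  delay : (ℕ → A) → ℕ → A
  delay f = cf (resolvent f)

  ⋆-suc : ∀ f g n → (f ⋆ g) (suc n) ≈ f 0 * g (suc n) + ((λ i → f (suc i)) ⋆ g) n
  ⋆-suc f g n = Σ<-suc (suc n) _

  ⋆-suc′ : ∀ f g n → (f ⋆ g) (suc n) ≈ (f ⋆ (λ i → g (suc i))) n + f (suc n) * g 0
  ⋆-suc′ f g n = +-cong
    (Σ<-cong-< (suc n) (λ i i<1+n → *-congˡ (reflexive (≡.cong g (ℕ.+-∸-assoc 1 (ℕ.≤-pred i<1+n))))))
    (*-congˡ (reflexive (≡.cong g (ℕ.n∸n≡0 n))))

  ⋆-congˡ : ∀ {f f′} g → f ≋ f′ → f ⋆ g ≋ f′ ⋆ g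
  ⋆-congˡ g f≋f′ n = Σ<-cong (suc n) (λ i → *-congʳ (f≋f′ i))

  ⋆-congʳ : ∀ f {g g′} → g ≋ g′ → f ⋆ g ≋ f ⋆ g′
  ⋆-congʳ f g≋g′ n = Σ<-cong (suc n) (λ i → *-congˡ (g≋g′ _))

  ⋆-comm : ∀ f g → f ⋆ g ≋ g ⋆ f
  ⋆-comm f g zero    = +-congˡ (*-comm _ _)
  ⋆-comm f g (suc n) = begin
    (f ⋆ g) (suc n)                              ≈⟨ ⋆-suc f g n ⟩
    f 0 * g (suc n) + ((λ i → f (suc i)) ⋆ g) n  ≈⟨ +-cong (*-comm _ _) (⋆-comm _ g n) ⟩
    g (suc n) * f 0 + (g ⋆ (λ i → f (suc i))) n  ≈⟨ +-comm _ _ ⟩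
    (g ⋆ (λ i → f (suc i))) n + g (suc n) * f 0  ≈⟨ ⋆-suc′ g f n ⟨
    (g ⋆ f) (suc n)                              ∎

  ⋆-distribʳ-+ : ∀ f f′ g → (λ i → f i + f′ i) ⋆ g ≋ λ n → (f ⋆ g) n + (f′ ⋆ g) n
  ⋆-distribʳ-+ f f′ g n = trans (Σ<-cong (suc n) (λ i → distribʳ _ _ _)) (Σ<-distrib-+ (suc n) _ _)

  ⋆-distribˡ-+ : ∀ f g g′ → f ⋆ (λ i → g i + g′ i) ≋ λ n → (f ⋆ g) n + (f ⋆ g′) n
  ⋆-distribˡ-+ f g g′ n = trans (Σ<-cong (suc n) (λ i → distribˡ _ _ _)) (Σ<-distrib-+ (suc n) _ _)

  ⋆-distribˡ-Σ< : ∀ m f (g : ℕ → ℕ → A) →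
                  f ⋆ (λ i → Σ< m (λ j → g j i)) ≋ λ n → Σ< m (λ j → (f ⋆ g j) n)
  ⋆-distribˡ-Σ< m f g n =
    trans (Σ<-cong (suc n) (λ i → *-distribˡ-Σ< m (f i) _)) (Σ<-comm (suc n) m _)

  ⋆-scaleˡ : ∀ x f g → (λ i → x * f i) ⋆ g ≋ λ n → x * (f ⋆ g) n
  ⋆-scaleˡ x f g n = trans (Σ<-cong (suc n) (λ i → *-assoc _ _ _)) (sym (*-distribˡ-Σ< (suc n) x _))

  ⋆-scaleʳ : ∀ x f g → f ⋆ (λ i → x * g i) ≋ λ n → x * (f ⋆ g) n
  ⋆-scaleʳ x f g n = trans (Σ<-cong (suc n) (λ i → x∙yz≈y∙xz (f i) x _)) (sym (*-distribˡ-Σ< (suc n) x _))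

  ⋆-Σ<-scaled : ∀ m f (k : ℕ → A) (g : ℕ → ℕ → A) →
                f ⋆ (λ i → Σ< m (λ j → k j * g j i)) ≋ λ n → Σ< m (λ j → k j * (f ⋆ g j) n)
  ⋆-Σ<-scaled m f k g n =
    trans (⋆-distribˡ-Σ< m f (λ j i → k j * g j i) n) (Σ<-cong m (λ j → ⋆-scaleʳ (k j) f (g j) n))

  ⋆-negʳ : ∀ f g → f ⋆ (λ i → - g i) ≋ λ n → - (f ⋆ g) n
  ⋆-negʳ f g n = trans (Σ<-cong (suc n) (λ i → sym (-‿distribʳ-* (f i) _))) (sym (-‿distrib-Σ< (suc n) _))

  ⋆-zeroʳ : ∀ f {g} → g ≋ (λ _ → 0#) → f ⋆ g ≋ λ _ → 0#
  ⋆-zeroʳ f g≈0 n = Σ<-zero (suc n) (λ i → trans (*-congˡ (g≈0 _)) (zeroʳ _))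

  ⋆-assoc : ∀ f g h → (f ⋆ g) ⋆ h ≋ f ⋆ (g ⋆ h)
  ⋆-assoc f g h zero = +-congˡ (trans (*-congʳ (+-identityˡ _))
                                (trans (*-assoc _ _ _) (*-congˡ (sym (+-identityˡ _)))))
  ⋆-assoc f g h (suc n) = begin
    ((f ⋆ g) ⋆ h) (suc n)
      ≈⟨ ⋆-suc (f ⋆ g) h n ⟩
    (f ⋆ g) 0 * h (suc n) + ((λ i → (f ⋆ g) (suc i)) ⋆ h) n
      ≈⟨ +-cong (*-congʳ (+-identityˡ _)) (⋆-congˡ h (⋆-suc f g) n) ⟩
    f 0 * g 0 * h (suc n) + ((λ i → f 0 * g (suc i) + (f′ ⋆ g) i) ⋆ h) n
      ≈⟨ +-congˡ (⋆-distribʳ-+ _ _ h n) ⟩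
    f 0 * g 0 * h (suc n) + (((λ i → f 0 * g (suc i)) ⋆ h) n + ((f′ ⋆ g) ⋆ h) n)
      ≈⟨ +-congˡ (+-cong (⋆-scaleˡ (f 0) _ h n) (⋆-assoc f′ g h n)) ⟩
    f 0 * g 0 * h (suc n) + (f 0 * (g′ ⋆ h) n + (f′ ⋆ (g ⋆ h)) n)
      ≈⟨ +-assoc _ _ _ ⟨
    f 0 * g 0 * h (suc n) + f 0 * (g′ ⋆ h) n + (f′ ⋆ (g ⋆ h)) n
      ≈⟨ +-congʳ (trans (+-congʳ (*-assoc _ _ _)) (sym (distribˡ _ _ _))) ⟩
    f 0 * (g 0 * h (suc n) + (g′ ⋆ h) n) + (f′ ⋆ (g ⋆ h)) n
      ≈⟨ +-congʳ (*-congˡ (⋆-suc g h n)) ⟨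
    f 0 * (g ⋆ h) (suc n) + (f′ ⋆ (g ⋆ h)) n
      ≈⟨ ⋆-suc f (g ⋆ h) n ⟨
    (f ⋆ (g ⋆ h)) (suc n) ∎
    where
    f′ g′ : ℕ → A
    f′ i = f (suc i)
    g′ i = g (suc i)

  const-⋆ : ∀ x g → cf (const x) ⋆ g ≋ λ n → x * g n
  const-⋆ x g zero    = +-identityˡ _
  const-⋆ x g (suc n) = begin
    (cf (const x) ⋆ g) (suc n)
      ≈⟨ ⋆-suc (cf (const x)) g n ⟩
    x * g (suc n) + ((λ i → cf (const x) (suc i)) ⋆ g) n
      ≈⟨ +-congˡ (Σ<-zero (suc n) (λ i → zeroˡ _)) ⟩
    x * g (suc n) + 0#
      ≈⟨ +-identityʳ _ ⟩
    x * g (suc n) ∎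

  ⋆-const : ∀ x f → f ⋆ cf (const x) ≋ λ n → x * f n
  ⋆-const x f n = trans (⋆-comm f _ n) (const-⋆ x f n)

  delay-⋆ : ∀ f g → delay f ⋆ g ≋ delay (f ⋆ g)
  delay-⋆ f g zero    = trans (+-identityˡ _) (zeroˡ _)
  delay-⋆ f g (suc n) = trans (⋆-suc (delay f) g n) (trans (+-congʳ (zeroˡ _)) (+-identityˡ _))

  ⋆-delay : ∀ f g → f ⋆ delay g ≋ delay (f ⋆ g)
  ⋆-delay f g zero    = trans (+-identityˡ _) (zeroʳ _)
  ⋆-delay f g (suc n) = trans (⋆-suc′ f (delay g) n) (trans (+-congˡ (zeroʳ _)) (+-identityʳ _))

  Σ<-antidiagonal-delay : ∀ n f g → Σ< n (λ s → g (n ∸ suc s) * f s) ≈ (f ⋆ delay g) n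
  Σ<-antidiagonal-delay zero    f g = sym (⋆-delay f g 0)
  Σ<-antidiagonal-delay (suc n) f g =
    trans (Σ<-cong (suc n) (λ s → *-comm _ _)) (sym (⋆-delay f g (suc n)))

  -- Coefficients of Laurent series

  coeffs : ℕ → Laurent → ℕ → A
  coeffs B s N = coeff s (+ B ℤ.- + N)

  coeff-top : ∀ s n → coeff s (+ top s ℤ.- + n) ≡ cf s n
  coeff-top s n with + top s ℤ.- (+ top s ℤ.- + n) | x-[x-y]≡y (+ top s) (+ n)
  ... | _ | ≡.refl = ≡.refl

  coeffs-top : ∀ {B} s → top s ≡ B → coeffs B s ≋ cf s
  coeffs-top s ≡.refl n = reflexive (coeff-top s n)

  coeff-above : ∀ {B} s e → top s ≤ B → + B ℤ.< e → coeff s e ≡ 0#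
  coeff-above {B} s e top≤B B<e with + top s ℤ.- e in eq
  ... | -[1+ _ ] = ≡.refl
  ... | + n      = ⊥-elim (ℤ.<-irrefl ≡.refl (ℤ.≤-<-trans e≤B B<e))
    where
    e≡ : e ≡ + top s ℤ.- + n
    e≡ = ≡.trans (≡.sym (x-[x-y]≡y (+ top s) e)) (≡.cong (λ x → + top s ℤ.- x) eq)
    e≤B : e ℤ.≤ + B
    e≤B = ≡.subst (ℤ._≤ + B) (≡.sym e≡)
            (ℤ.≤-trans (≡.subst (ℤ._≤ + top s) (≡.sym (ℤ.m-n≡m⊖n (top s) n)) (ℤ.m⊖n≤m (top s) n))
                       (ℤ.+≤+ top≤B))

  ≈L-by-coeffs : ∀ B {s t} → top s ≤ B → top t ≤ B → coeffs B s ≋ coeffs B t → s ≈L t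
  ≈L-by-coeffs B {s} {t} s≤B t≤B s≋t e with above-or-below B e
  ... | inj₁ B<e         = reflexive (≡.trans (coeff-above s e s≤B B<e) (≡.sym (coeff-above t e t≤B B<e)))
  ... | inj₂ (n , ≡.refl) = s≋t n

  coeff-+L : ∀ s t e → coeff (s +L t) e ≈ coeff s e + coeff t e
  coeff-+L s t e with above-or-below (top s ℕ.⊔ top t) e
  ... | inj₁ T<e = begin
    coeff (s +L t) e       ≡⟨ coeff-above (s +L t) e ℕ.≤-refl T<e ⟩
    0#                     ≈⟨ +-identityʳ 0# ⟨
    0# + 0#                ≡⟨ ≡.cong₂ _+_ (coeff-above s e (ℕ.m≤m⊔n (top s) (top t)) T<e)
                                          (coeff-above t e (ℕ.m≤n⊔m (top s) (top t)) T<e) ⟨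
    coeff s e + coeff t e  ∎
  ... | inj₂ (n , ≡.refl) = reflexive (coeff-top (s +L t) n)

  coeff-negL : ∀ s e → coeff (-L s) e ≈ - coeff s e
  coeff-negL s e with + top s ℤ.- e
  ... | + n      = refl
  ... | -[1+ _ ] = sym -0#≈0#

  coeff-const0 : ∀ e → coeff (const 0#) e ≈ 0#
  coeff-const0 e with + 0 ℤ.- e
  ... | + zero   = refl
  ... | + suc _  = refl
  ... | -[1+ _ ] = refl

  coeff-ΣL< : ∀ n f e → coeff (ΣL< n f) e ≈ Σ< n (λ i → coeff (f i) e)
  coeff-ΣL< zero    f e = coeff-const0 e
  coeff-ΣL< (suc n) f e = trans (coeff-+L (ΣL< n f) (f n) e) (+-congʳ (coeff-ΣL< n f e))

  top-ΣL< : ∀ n f → (∀ i → top (f i) ≡ 0) → top (ΣL< n f) ≡ 0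
  top-ΣL< zero    f top≡0 = ≡.refl
  top-ΣL< (suc n) f top≡0 = ≡.cong₂ ℕ._⊔_ (top-ΣL< n f top≡0) (top≡0 n)

  cf-ΣL< : ∀ n f → (∀ i → top (f i) ≡ 0) → cf (ΣL< n f) ≋ λ m → Σ< n (λ i → cf (f i) m)
  cf-ΣL< n f top≡0 m = begin
    cf (ΣL< n f) m                    ≈⟨ coeffs-top (ΣL< n f) (top-ΣL< n f top≡0) m ⟨
    coeff (ΣL< n f) (+ 0 ℤ.- + m)     ≈⟨ coeff-ΣL< n f (+ 0 ℤ.- + m) ⟩
    Σ< n (λ i → coeffs 0 (f i) m)     ≈⟨ Σ<-cong n (λ i → coeffs-top (f i) (top≡0 i) m) ⟩
    Σ< n (λ i → cf (f i) m)           ∎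

  coeffs-1-top0 : ∀ s → top s ≡ 0 → coeffs 1 s ≋ delay (cf s)
  coeffs-1-top0 s top≡0 zero    = reflexive (coeff-above s (+ 1) (ℕ.≤-reflexive top≡0) (ℤ.+<+ (s≤s z≤n)))
  coeffs-1-top0 s top≡0 (suc n) = trans (reflexive (≡.cong (coeff s) (1-[1+n]≡0-n n))) (coeffs-top s top≡0 n)

  delay-cong : ∀ {f g} → f ≋ g → delay f ≋ delay g
  delay-cong f≋g zero    = refl
  delay-cong f≋g (suc n) = f≋g n

  delay-Σ<-scaled : ∀ m (k : ℕ → A) (f : ℕ → ℕ → A) →
                    delay (λ t → Σ< m (λ j → k j * f j t)) ≋ λ n → Σ< m (λ j → k j * delay (f j) n)
  delay-Σ<-scaled m k f zero    = sym (Σ<-zero m (λ j → zeroʳ (k j)))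
  delay-Σ<-scaled m k f (suc n) = refl

  resolvent-*L : ∀ {u x y} → u ≋ x ⋆ delay y → resolvent u ≈L resolvent x *L resolvent y
  resolvent-*L {u} {x} {y} u≋x⋆y = ≈L-by-coeffs 0 z≤n z≤n λ N → begin
    coeffs 0 (resolvent u) N           ≈⟨ coeffs-top (resolvent u) ≡.refl N ⟩
    delay u N                          ≈⟨ delay-cong u≋x⋆y N ⟩
    delay (x ⋆ delay y) N              ≈⟨ delay-⋆ x (delay y) N ⟨
    (delay x ⋆ delay y) N              ≈⟨ coeffs-top (resolvent x *L resolvent y) ≡.refl N ⟨
    coeffs 0 (resolvent x *L resolvent y) N ∎

  -- The recurrence is the coefficient of z^(-M-1) in resolvent x · (z - α - S) = 1.
  resolvent-inverse : ∀ {x α S} → top S ≡ 0 → x 0 ≈ 1# →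
                      (∀ M → x (suc M) ≈ α * x M + (x ⋆ cf S) M) →
                      resolvent x *L (zL -L const α -L S) ≈L oneL
  resolvent-inverse {x} {α} {S} top-S x₀≈1 x-rec =
    ≈L-by-coeffs 1 (ℕ.≤-reflexive top-F) z≤n λ N → begin
      coeffs 1 (resolvent x *L F) N   ≈⟨ coeffs-top (resolvent x *L F) top-F N ⟩
      (delay x ⋆ cf F) N              ≈⟨ ⋆-congʳ (delay x) (coeffs-top F top-F) N ⟨
      (delay x ⋆ coeffs 1 F) N        ≈⟨ delay-⋆ x (coeffs 1 F) N ⟩
      delay (x ⋆ coeffs 1 F) N        ≈⟨ delay-cong x⋆F≋1 N ⟩
      delay (cf oneL) N               ≈⟨ coeffs-1-top0 oneL ≡.refl N ⟨
      coeffs 1 oneL N                 ∎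
    where
    F : Laurent
    F = zL -L const α -L S

    top-F : top F ≡ 1
    top-F = ≡.cong (1 ℕ.⊔_) top-S

    coeff-F : ∀ e → coeff F e ≈ coeff zL e + - coeff (const α) e + - coeff S e
    coeff-F e = trans (coeff-+L _ _ e)
                      (+-cong (trans (coeff-+L _ _ e) (+-congˡ (coeff-negL _ e))) (coeff-negL S e))

    F₀ : coeffs 1 F 0 ≈ 1#
    F₀ = begin
      coeffs 1 F 0                          ≈⟨ coeff-F (+ 1 ℤ.- + 0) ⟩
      1# + - coeffs 1 (const α) 0 + - coeffs 1 S 0
        ≈⟨ +-cong (+-congˡ (-‿cong (coeffs-1-top0 (const α) ≡.refl 0))) (-‿cong (coeffs-1-top0 S top-S 0)) ⟩
      1# + - 0# + - 0#                      ≈⟨ +-cong (+-congˡ -0#≈0#) -0#≈0# ⟩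
      1# + 0# + 0#                          ≈⟨ trans (+-identityʳ _) (+-identityʳ _) ⟩
      1#                                    ∎

    F-suc : ∀ M → coeffs 1 F (suc M) ≈ - cf (const α) M + - cf S M
    F-suc M = begin
      coeffs 1 F (suc M)                    ≈⟨ coeff-F (+ 1 ℤ.- + suc M) ⟩
      coeffs 1 zL (suc M) + - coeffs 1 (const α) (suc M) + - coeffs 1 S (suc M)
        ≈⟨ +-cong (+-cong (reflexive (coeff-top zL (suc M))) (-‿cong (coeffs-1-top0 (const α) ≡.refl (suc M))))
                  (-‿cong (coeffs-1-top0 S top-S (suc M))) ⟩
      0# + - cf (const α) M + - cf S M      ≈⟨ +-congʳ (+-identityˡ _) ⟩
      - cf (const α) M + - cf S M           ∎

    x⋆F≋1 : x ⋆ coeffs 1 F ≋ cf oneL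
    x⋆F≋1 zero    = trans (+-identityˡ _) (trans (*-congˡ F₀) (trans (*-identityʳ _) x₀≈1))
    x⋆F≋1 (suc M) = begin
      (x ⋆ coeffs 1 F) (suc M)
        ≈⟨ ⋆-suc′ x (coeffs 1 F) M ⟩
      (x ⋆ (λ N → coeffs 1 F (suc N))) M + x (suc M) * coeffs 1 F 0
        ≈⟨ +-cong (⋆-congʳ x F-suc M) (trans (*-congˡ F₀) (*-identityʳ _)) ⟩
      (x ⋆ (λ N → - cf (const α) N + - cf S N)) M + x (suc M)
        ≈⟨ +-cong (trans (⋆-distribˡ-+ x (λ N → - cf (const α) N) (λ N → - cf S N) M)
                         (+-cong (⋆-negʳ x (cf (const α)) M) (⋆-negʳ x (cf S) M))) (x-rec M) ⟩
      (- (x ⋆ cf (const α)) M + - (x ⋆ cf S) M) + (α * x M + (x ⋆ cf S) M)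
        ≈⟨ +-congʳ (+-congʳ (-‿cong (⋆-const α x M))) ⟩
      (- (α * x M) + - (x ⋆ cf S) M) + (α * x M + (x ⋆ cf S) M)
        ≈⟨ +-congʳ (-‿+-comm _ _) ⟩
      - (α * x M + (x ⋆ cf S) M) + (α * x M + (x ⋆ cf S) M)
        ≈⟨ -‿inverseˡ _ ⟩
      0# ∎

  -- Linear operators

  record IsLinear {I : Set} (L : (I → A) → (I → A)) : Set (c ⊔ ℓ) where
    field
      ≋-cong : ∀ {v w} → v ≋ w → L v ≋ L w
      +-homo : ∀ v w → L (λ y → v y + w y) ≋ λ x → L v x + L w x
      *-homo : ∀ k v → L (λ y → k * v y) ≋ λ x → k * L v x

  module _ {I : Set} {L : (I → A) → (I → A)} (L-linear : IsLinear L) where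
    open IsLinear L-linear

    linear-0 : L (λ _ → 0#) ≋ λ _ → 0#
    linear-0 x = trans (≋-cong (λ _ → sym (zeroˡ 0#)) x) (trans (*-homo 0# (λ _ → 0#) x) (zeroˡ _))

    linear-Σ< : ∀ m (v : ℕ → I → A) → L (λ y → Σ< m (λ j → v j y)) ≋ λ x → Σ< m (λ j → L (v j) x)
    linear-Σ< zero    v x = linear-0 x
    linear-Σ< (suc m) v x = trans (+-homo _ _ x) (+-congʳ (linear-Σ< m v x))

    linear-Σ<-scaled : ∀ m (k : ℕ → A) (v : ℕ → I → A) →
                       L (λ y → Σ< m (λ j → k j * v j y)) ≋ λ x → Σ< m (λ j → k j * L (v j) x)
    linear-Σ<-scaled m k v x =
      trans (linear-Σ< m (λ j y → k j * v j y) x) (Σ<-cong m (λ j → *-homo (k j) (v j) x))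

  pow-linear : ∀ {I : Set} {L : (I → A) → (I → A)} → IsLinear L → ∀ n → IsLinear (pow n L)
  pow-linear L-linear zero = record
    { ≋-cong = λ v≋w → v≋w ; +-homo = λ _ _ _ → refl ; *-homo = λ _ _ _ → refl }
  pow-linear L-linear (suc n) = record
    { ≋-cong = λ v≋w → ≋-cong (IsLinear.≋-cong Lⁿ v≋w)
    ; +-homo = λ v w x → trans (≋-cong (IsLinear.+-homo Lⁿ v w) x) (+-homo _ _ x)
    ; *-homo = λ k v x → trans (≋-cong (IsLinear.*-homo Lⁿ k v) x) (*-homo k _ x)
    }
    where
    open IsLinear L-linear
    Lⁿ = pow-linear L-linear n

  pow-cong : ∀ {I : Set} {L : (I → A) → (I → A)} → IsLinear L → ∀ n {v w} → v ≋ w → pow n L v ≋ pow n L w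
  pow-cong L-linear n = IsLinear.≋-cong (pow-linear L-linear n)

  pow-suc′ : ∀ {a} {X : Set a} n (f : X → X) x → pow (suc n) f x ≡ pow n f (f x)
  pow-suc′ zero    f x = ≡.refl
  pow-suc′ (suc n) f x = ≡.cong f (pow-suc′ n f x)

  duhamel : ∀ {I : Set} {L : (I → A) → (I → A)} → IsLinear L → (k r : ℕ → I → A) →
            (∀ n → L (k n) ≋ λ x → k (suc n) x + r n x) →
            ∀ n → pow n L (k 0) ≋ λ x → k n x + Σ< n (λ s → pow s L (r (n ∸ suc s)) x)
  duhamel L-linear k r step zero    x = sym (+-identityʳ _)
  duhamel {L = L} L-linear k r step (suc n) x = begin
    L (pow n L (k 0)) x
      ≈⟨ ≋-cong (duhamel L-linear k r step n) x ⟩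
    L (λ y → k n y + Σ< n (λ s → pow s L (r (n ∸ suc s)) y)) x
      ≈⟨ +-homo _ _ x ⟩
    L (k n) x + L (λ y → Σ< n (λ s → pow s L (r (n ∸ suc s)) y)) x
      ≈⟨ +-cong (step n x) (linear-Σ< L-linear n (λ s → pow s L (r (n ∸ suc s))) x) ⟩
    k (suc n) x + r n x + Σ< n (λ s → L (pow s L (r (n ∸ suc s))) x)
      ≈⟨ +-assoc _ _ _ ⟩
    k (suc n) x + (r n x + Σ< n (λ s → L (pow s L (r (n ∸ suc s))) x))
      ≈⟨ +-congˡ (Σ<-suc n _) ⟨
    k (suc n) x + Σ< (suc n) (λ s → pow s L (r (n ∸ s)) x) ∎
    where open IsLinear L-linear

  duhamel-⋆ : ∀ {I : Set} {L : (I → A) → (I → A)} → IsLinear L →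
              (k : ℕ → I → A) (m : ℕ) (c : ℕ → ℕ → A) (u : ℕ → I → A) →
              (∀ n → L (k n) ≋ λ x → k (suc n) x + Σ< m (λ j → c j n * u j x)) →
              ∀ x₀ → (∀ n → k n x₀ ≈ 0#) →
              ∀ n → pow n L (k 0) x₀ ≈ Σ< m (λ j → ((λ s → pow s L (u j) x₀) ⋆ delay (c j)) n)
  duhamel-⋆ {L = L} L-linear k m c u step x₀ kₙx₀≈0 n = begin
    pow n L (k 0) x₀
      ≈⟨ duhamel L-linear k _ step n x₀ ⟩
    k n x₀ + Σ< n (λ s → pow s L (λ x → Σ< m (λ j → c j (n ∸ suc s) * u j x)) x₀)
      ≈⟨ +-cong (kₙx₀≈0 n) (Σ<-cong n (λ s → linear-Σ<-scaled (pow-linear L-linear s) m _ u x₀)) ⟩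
    0# + Σ< n (λ s → Σ< m (λ j → c j (n ∸ suc s) * pow s L (u j) x₀))
      ≈⟨ trans (+-identityˡ _) (Σ<-comm n m _) ⟩
    Σ< m (λ j → Σ< n (λ s → c j (n ∸ suc s) * pow s L (u j) x₀))
      ≈⟨ Σ<-cong m (λ j → Σ<-antidiagonal-delay n (λ s → pow s L (u j) x₀) (c j)) ⟩
    Σ< m (λ j → ((λ s → pow s L (u j) x₀) ⋆ delay (c j)) n) ∎

  duhamel-⋆₁ : ∀ {I : Set} {L : (I → A) → (I → A)} → IsLinear L →
               (k : ℕ → I → A) (c : ℕ → A) (u : I → A) →
               (∀ n → L (k n) ≋ λ x → k (suc n) x + c n * u x) →
               ∀ x₀ → (∀ n → k n x₀ ≈ 0#) →
               ∀ n → pow n L (k 0) x₀ ≈ ((λ s → pow s L u x₀) ⋆ delay c) n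
  duhamel-⋆₁ L-linear k c u step x₀ kₙx₀≈0 n =
    trans (duhamel-⋆ L-linear k 1 (λ _ → c) (λ _ → u)
                     (λ n x → trans (step n x) (+-congˡ (sym (+-identityˡ _)))) x₀ kₙx₀≈0 n)
          (+-identityˡ _)

  -- opH, opB and opW all have this shape, which gives their linearity at once.
  banded : {I : Set} → (I → I) → ℕ → (ℕ → I → Bool) → (ℕ → I → A) → (ℕ → I → I) →
           (I → A) → I → A
  banded σ N g w ι v m = v (σ m) + Σ< N (λ k → if g k m then w k m * v (ι k m) else 0#)

  banded-linear : {I : Set} (σ : I → I) (N : ℕ) (g : ℕ → I → Bool) (w : ℕ → I → A) (ι : ℕ → I → I) →
                  IsLinear (banded σ N g w ι)
  banded-linear σ N g w ι = record
    { ≋-cong = λ v≋w m → +-cong (v≋w (σ m)) (Σ<-cong N (λ k → guarded-cong (g k m) (*-congˡ (v≋w _))))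
    ; +-homo = λ v v′ m → trans
        (+-congˡ (trans (Σ<-cong N (λ k → guarded-distrib (g k m) (w k m) (v (ι k m)) (v′ (ι k m))))
                        (Σ<-distrib-+ N _ _)))
        (interchange _ _ _ _)
    ; *-homo = λ x v m → trans
        (+-congˡ (trans (Σ<-cong N (λ k → guarded-scale (g k m) x (w k m) (v (ι k m))))
                        (sym (*-distribˡ-Σ< N x _))))
        (sym (distribˡ _ _ _))
    }
    where
    guarded-cong : ∀ b {x y} → x ≈ y → (if b then x else 0#) ≈ (if b then y else 0#)
    guarded-cong true  x≈y = x≈y
    guarded-cong false x≈y = refl
    guarded-distrib : ∀ b x u v → (if b then x * (u + v) else 0#) ≈
                                  (if b then x * u else 0#) + (if b then x * v else 0#)
    guarded-distrib true  x u v = distribˡ x u v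
    guarded-distrib false x u v = sym (+-identityʳ 0#)
    guarded-scale : ∀ b k x u → (if b then x * (k * u) else 0#) ≈ k * (if b then x * u else 0#)
    guarded-scale true  k x u = x∙yz≈y∙xz x k u
    guarded-scale false k x u = sym (zeroʳ k)

  -- The operators H_q

  if-≤ᵇ-yes : ∀ {k m} {x y : A} → k ≤ m → (if k ℕ.≤ᵇ m then x else y) ≡ x
  if-≤ᵇ-yes {k} {m} {x} {y} k≤m = ≡.cong (λ b → if b then x else y) (dec-true (k ℕ.≤? m) k≤m)

  if-≤ᵇ-no : ∀ {k m} {x y : A} → ¬ k ≤ m → (if k ℕ.≤ᵇ m then x else y) ≡ y
  if-≤ᵇ-no {k} {m} {x} {y} k≰m = ≡.cong (λ b → if b then x else y) (dec-false (k ℕ.≤? m) k≰m)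

  e-diag : ∀ j → e j j ≈ 1#
  e-diag j = reflexive (≡.cong (λ b → if b then 1# else 0#) (dec-true (j ℕ.≟ j) ≡.refl))

  e-off : ∀ {j m} → j ≢ m → e j m ≈ 0#
  e-off {j} {m} j≢m = reflexive (≡.cong (λ b → if b then 1# else 0#) (dec-false (j ℕ.≟ m) j≢m))

  e-∸ : ∀ j {k m} → k ≤ m → e j (m ∸ k) ≡ e (k ℕ.+ j) m
  e-∸ j z≤n       = ≡.refl
  e-∸ j (s≤s k≤m) = e-∸ j k≤m

  *-e-off : ∀ x {j m} → j ≢ m → x * e j m ≈ 0#
  *-e-off x j≢m = trans (*-congˡ (e-off j≢m)) (zeroʳ x)

  *-e-cong : ∀ {x y} j m → (j ≡ m → x ≈ y) → x * e j m ≈ y * e j m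
  *-e-cong j m x≈y with j ℕ.≟ m
  ... | yes ≡.refl = *-congʳ (x≈y ≡.refl)
  ... | no  j≢m    = trans (*-e-off _ j≢m) (sym (*-e-off _ j≢m))

  module Operators (p : ℕ) (a : ℕ → ℤ → A) where

    H-linear : ∀ q → IsLinear (opH p a q)
    H-linear q = banded-linear suc (suc p) (λ k m → k ℕ.≤ᵇ m)
                   (λ k m → a k (+ (m ∸ k) ℤ.+ + q)) (λ k m → m ∸ k)

    B-linear : ∀ q → IsLinear (opB p a q)
    B-linear q = banded-linear suc (suc p) (λ k m → k ℕ.≤ᵇ m)
                   (λ k m → a k (ℤ.- + k ℤ.- + q ℤ.- + (m ∸ k))) (λ k m → m ∸ k)

    W-linear : IsLinear (opW p a)
    W-linear = banded-linear (λ m → m ℤ.+ + 1) (suc p) (λ _ _ → true)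
                 (λ k m → a k (m ℤ.- + k)) (λ k m → m ℤ.- + k)

    H-e₀ : ∀ q → opH p a q (e 0) ≋ λ m → Σ< (suc p) (λ k → a k (+ q) * e k m)
    H-e₀ q m = trans (+-identityˡ _) (Σ<-cong (suc p) term)
      where
      term : ∀ k → (if k ℕ.≤ᵇ m then a k (+ (m ∸ k) ℤ.+ + q) * e 0 (m ∸ k) else 0#) ≈ a k (+ q) * e k m
      term k with k ℕ.≤? m
      ... | yes k≤m = begin
        (if k ℕ.≤ᵇ m then a k (+ (m ∸ k) ℤ.+ + q) * e 0 (m ∸ k) else 0#)
          ≡⟨ ≡.trans (if-≤ᵇ-yes k≤m) (≡.cong (a k (+ (m ∸ k) ℤ.+ + q) *_)
               (≡.trans (e-∸ 0 k≤m) (≡.cong (λ j → e j m) (ℕ.+-identityʳ k)))) ⟩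
        a k (+ (m ∸ k) ℤ.+ + q) * e k m
          ≈⟨ *-e-cong k m (λ { ≡.refl → reflexive (≡.cong (λ d → a k (+ d ℤ.+ + q)) (ℕ.n∸n≡0 k)) }) ⟩
        a k (+ q) * e k m ∎
      ... | no k≰m = trans (reflexive (if-≤ᵇ-no k≰m))
                           (sym (*-e-off _ (λ k≡m → k≰m (ℕ.≤-reflexive k≡m))))

    -- On the span of e₁, e₂, … the operator H_q is a shifted copy of H_{q+1}, up to a leak into e₀.
    H-delay : ∀ q v → opH p a q (delay v) ≋ λ m → delay (opH p a (suc q) v) m + v 0 * e 0 m
    H-delay q v zero = begin
      v 0 + Σ< (suc p) (λ k → if k ℕ.≤ᵇ 0 then a k (+ (0 ∸ k) ℤ.+ + q) * delay v (0 ∸ k) else 0#)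
        ≈⟨ +-congˡ (Σ<-zero (suc p) term) ⟩
      v 0 + 0#                ≈⟨ +-identityʳ _ ⟩
      v 0                     ≈⟨ trans (+-identityˡ _) (*-identityʳ _) ⟨
      0# + v 0 * 1#           ∎
      where
      term : ∀ k → (if k ℕ.≤ᵇ 0 then a k (+ (0 ∸ k) ℤ.+ + q) * delay v (0 ∸ k) else 0#) ≈ 0#
      term zero    = zeroʳ _
      term (suc k) = refl
    H-delay q v (suc m) =
      trans (+-congˡ (Σ<-cong (suc p) term)) (sym (trans (+-congˡ (zeroʳ (v 0))) (+-identityʳ _)))
      where
      term : ∀ k → (if k ℕ.≤ᵇ suc m then a k (+ (suc m ∸ k) ℤ.+ + q) * delay v (suc m ∸ k) else 0#)
                 ≈ (if k ℕ.≤ᵇ m then a k (+ (m ∸ k) ℤ.+ + suc q) * v (m ∸ k) else 0#)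
      term k with k ℕ.≤? m
      ... | yes k≤m = reflexive (≡.trans (if-≤ᵇ-yes (ℕ.m≤n⇒m≤1+n k≤m)) (≡.trans
              (≡.cong (λ d → a k (+ d ℤ.+ + q) * delay v d) (ℕ.+-∸-assoc 1 k≤m))
              (≡.trans (≡.cong (λ d → a k (+ d) * v (m ∸ k)) (≡.sym (ℕ.+-suc (m ∸ k) q)))
                       (≡.sym (if-≤ᵇ-yes k≤m)))))
      ... | no k≰m with k ℕ.≟ suc m
      ...   | yes ≡.refl = trans (reflexive (≡.trans (if-≤ᵇ-yes (ℕ.≤-refl {suc m}))
                                 (≡.cong (λ d → a (suc m) (+ d ℤ.+ + q) * delay v d) (ℕ.n∸n≡0 m))))
                               (trans (zeroʳ _) (reflexive (≡.sym (if-≤ᵇ-no k≰m))))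
      ...   | no k≢1+m   = reflexive (≡.trans (if-≤ᵇ-no (λ k≤1+m → k≢1+m (ℕ.≤-antisym k≤1+m
                                   (ℕ.≰⇒> k≰m)))) (≡.sym (if-≤ᵇ-no k≰m)))

    h : ℕ → ℕ → ℕ → A
    h q j n = pow n (opH p a q) (e j) 0

    e-suc≋delay : ∀ i → e (suc i) ≋ delay (e i)
    e-suc≋delay i zero    = refl
    e-suc≋delay i (suc m) = refl

    -- A path from e_{i+1} back to e₀ first reaches e₀ at some time s; before that it is a
    -- path of H_{q+1} from e_i.
    h-first-passage : ∀ q i → h q (suc i) ≋ h q 0 ⋆ delay (h (suc q) i)
    h-first-passage q i n =
      trans (pow-cong (H-linear q) n (e-suc≋delay i) 0)
            (duhamel-⋆₁ (H-linear q) (λ t → delay (pow t (opH p a (suc q)) (e i))) (h (suc q) i) (e 0)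
                        (λ t → H-delay q (pow t (opH p a (suc q)) (e i))) 0 (λ _ → refl) n)

    h-step : ∀ q n → h q 0 (suc n) ≈ Σ< (suc p) (λ k → a k (+ q) * h q k n)
    h-step q n = begin
      pow (suc n) (opH p a q) (e 0) 0                         ≡⟨ ≡.cong (λ v → v 0) (pow-suc′ n (opH p a q) (e 0)) ⟩
      pow n (opH p a q) (opH p a q (e 0)) 0                   ≈⟨ pow-cong (H-linear q) n (H-e₀ q) 0 ⟩
      pow n (opH p a q) (λ m → Σ< (suc p) (λ k → a k (+ q) * e k m)) 0
        ≈⟨ linear-Σ<-scaled (pow-linear (H-linear q) n) (suc p) _ _ 0 ⟩
      Σ< (suc p) (λ k → a k (+ q) * h q k n)                  ∎

    φ-suc : ∀ q i → φ p a q (suc i) ≈L φ p a q 0 *L φ p a (suc q) i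
    φ-suc q i = resolvent-*L (h-first-passage q i)

    φ₀-inverse : ∀ q → φ p a q 0 *L (zL -L const (a 0 (+ q))
                         -L ΣL< p (λ i → const (a (suc i) (+ q)) *L φ p a (suc q) i)) ≈L oneL
    φ₀-inverse q = resolvent-inverse (top-ΣL< p _ (λ _ → ≡.refl)) (e-diag 0) recurrence
      where
      cf-S : ∀ m → cf (ΣL< p (λ i → const (a (suc i) (+ q)) *L φ p a (suc q) i)) m
                   ≈ Σ< p (λ i → a (suc i) (+ q) * delay (h (suc q) i) m)
      cf-S m = trans (cf-ΣL< p _ (λ _ → ≡.refl) m)
                     (Σ<-cong p (λ i → const-⋆ (a (suc i) (+ q)) (delay (h (suc q) i)) m))

      recurrence : ∀ M → h q 0 (suc M) ≈ a 0 (+ q) * h q 0 M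
                         + (h q 0 ⋆ cf (ΣL< p (λ i → const (a (suc i) (+ q)) *L φ p a (suc q) i))) M
      recurrence M = begin
        h q 0 (suc M)
          ≈⟨ trans (h-step q M) (Σ<-suc p _) ⟩
        a 0 (+ q) * h q 0 M + Σ< p (λ i → a (suc i) (+ q) * h q (suc i) M)
          ≈⟨ +-congˡ (Σ<-cong p (λ i → *-congˡ (h-first-passage q i M))) ⟩
        a 0 (+ q) * h q 0 M + Σ< p (λ i → a (suc i) (+ q) * (h q 0 ⋆ delay (h (suc q) i)) M)
          ≈⟨ +-congˡ (trans (⋆-congʳ (h q 0) cf-S M) (⋆-Σ<-scaled p (h q 0) _ (λ i → delay (h (suc q) i)) M)) ⟨
        a 0 (+ q) * h q 0 M + (h q 0 ⋆ cf (ΣL< p (λ i → const (a (suc i) (+ q)) *L φ p a (suc q) i))) M ∎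

    -- The operator W

    ê-diag : ∀ j → ê j j ≈ 1#
    ê-diag j = reflexive (≡.cong (λ b → if b then 1# else 0#)
                      (≡.trans (isYes≗does (j ℤ.≟ j)) (dec-true (j ℤ.≟ j) ≡.refl)))

    ê-off : ∀ {j m} → j ≢ m → ê j m ≈ 0#
    ê-off {j} {m} j≢m = reflexive (≡.cong (λ b → if b then 1# else 0#)
                               (≡.trans (isYes≗does (j ℤ.≟ m)) (dec-false (j ℤ.≟ m) j≢m)))

    *-ê-off : ∀ x {j m} → j ≢ m → x * ê j m ≈ 0#
    *-ê-off x j≢m = trans (*-congˡ (ê-off j≢m)) (zeroʳ x)

    raise : (ℕ → A) → ℤ → A
    raise v (+ zero)   = 0#
    raise v (+ suc m)  = v m
    raise v -[1+ _ ]   = 0#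

    ê-suc≋raise : ∀ i → ê (+ suc i) ≋ raise (e i)
    ê-suc≋raise i (+ zero)  = ê-off {+ suc i} {+ 0} (λ ())
    ê-suc≋raise i (+ suc m) = reflexive (≡.cong (λ b → if b then 1# else 0#) (isYes≗does (+ suc i ℤ.≟ + suc m)))
    ê-suc≋raise i -[1+ _ ]  = refl

    W-ê₀ : opW p a (ê (+ 0)) ≋ λ x → ê -[1+ 0 ] x + Σ< (suc p) (λ k → a k (+ 0) * ê (+ k) x)
    W-ê₀ x = +-cong left (Σ<-cong (suc p) term)
      where
      left : ê (+ 0) (x ℤ.+ + 1) ≈ ê -[1+ 0 ] x
      left with x ℤ.≟ -[1+ 0 ]
      ... | yes ≡.refl = refl
      ... | no x≢-1    = trans (ê-off (λ 0≡x+1 → x≢-1 (ℤ.i-j≡0⇒i≡j x -[1+ 0 ] (≡.sym 0≡x+1))))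
                               (sym (ê-off (λ -1≡x → x≢-1 (≡.sym -1≡x))))
      term : ∀ k → a k (x ℤ.- + k) * ê (+ 0) (x ℤ.- + k) ≈ a k (+ 0) * ê (+ k) x
      term k with x ℤ.≟ + k
      ... | yes ≡.refl = trans (reflexive (≡.cong (λ d → a k d * ê (+ 0) d) (ℤ.+-inverseʳ (+ k))))
                               (*-congˡ (trans (ê-diag (+ 0)) (sym (ê-diag (+ k)))))
      ... | no x≢k     = trans (*-ê-off _ (λ 0≡x-k → x≢k (ℤ.i-j≡0⇒i≡j x (+ k) (≡.sym 0≡x-k))))
                               (sym (*-ê-off _ (λ k≡x → x≢k (≡.sym k≡x))))

    W-raise : ∀ v → opW p a (raise v) ≋ λ x → raise (opH p a 1 v) x + v 0 * ê (+ 0) x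
    W-raise v (+ zero) = begin
      v 0 + Σ< (suc p) (λ k → a k (+ 0 ℤ.- + k) * raise v (+ 0 ℤ.- + k))
        ≈⟨ +-congˡ (Σ<-zero (suc p) (λ k → trans (*-congˡ (reflexive (raise-nonpos k))) (zeroʳ _))) ⟩
      v 0 + 0#                ≈⟨ +-identityʳ _ ⟩
      v 0                     ≈⟨ trans (+-identityˡ _) (trans (*-congˡ (ê-diag (+ 0))) (*-identityʳ _)) ⟨
      0# + v 0 * ê (+ 0) (+ 0) ∎
      where
      raise-nonpos : ∀ k → raise v (+ 0 ℤ.- + k) ≡ 0#
      raise-nonpos zero    = ≡.refl
      raise-nonpos (suc k) = ≡.refl
    W-raise v (+ suc m) = begin
      v (m ℕ.+ 1) + Σ< (suc p) (λ k → a k (+ suc m ℤ.- + k) * raise v (+ suc m ℤ.- + k))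
        ≈⟨ +-cong (reflexive (≡.cong v (ℕ.+-comm m 1))) (Σ<-cong (suc p) term) ⟩
      opH p a 1 v m           ≈⟨ +-identityʳ _ ⟨
      opH p a 1 v m + 0#      ≈⟨ +-congˡ (*-ê-off (v 0) {+ 0} {+ suc m} (λ ())) ⟨
      opH p a 1 v m + v 0 * ê (+ 0) (+ suc m) ∎
      where
      term : ∀ k → a k (+ suc m ℤ.- + k) * raise v (+ suc m ℤ.- + k)
                 ≈ (if k ℕ.≤ᵇ m then a k (+ (m ∸ k) ℤ.+ + 1) * v (m ∸ k) else 0#)
      term k with k ℕ.≤? m
      ... | yes k≤m = reflexive (≡.trans (≡.cong (λ d → a k d * raise v d) (+m-+n≡+[m∸n] (ℕ.m≤n⇒m≤1+n k≤m)))
                     (≡.trans (≡.cong (λ d → a k (+ d) * raise v (+ d)) (ℕ.+-∸-assoc 1 k≤m))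
                     (≡.trans (≡.cong (λ d → a k (+ d) * v (m ∸ k)) (ℕ.+-comm 1 (m ∸ k)))
                              (≡.sym (if-≤ᵇ-yes k≤m)))))
      ... | no k≰m  = trans (*-congˡ (reflexive (≡.trans (≡.cong (raise v) (+m-+n≡-[n∸m] (ℕ.≰⇒> k≰m)))
                                                    (raise-neg (k ∸ suc m)))))
                            (trans (zeroʳ _) (reflexive (≡.sym (if-≤ᵇ-no k≰m))))
        where
        raise-neg : ∀ d → raise v (ℤ.- + d) ≡ 0#
        raise-neg zero    = ≡.refl
        raise-neg (suc d) = ≡.refl
    W-raise v -[1+ m ] = begin
      raise v (-[1+ m ] ℤ.+ + 1) + Σ< (suc p) (λ k → a k (-[1+ m ] ℤ.- + k) * raise v (-[1+ m ] ℤ.- + k))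
        ≈⟨ +-cong (reflexive (raise-succ m))
                  (Σ<-zero (suc p) (λ k → trans (*-congˡ (reflexive (raise-pred k))) (zeroʳ _))) ⟩
      0# + 0#                 ≈⟨ +-congˡ (zeroʳ (v 0)) ⟨
      0# + v 0 * 0#           ≈⟨ +-congˡ (*-congˡ (ê-off {+ 0} { -[1+ m ]} (λ ()))) ⟨
      0# + v 0 * ê (+ 0) -[1+ m ] ∎
      where
      raise-succ : ∀ m → raise v (-[1+ m ] ℤ.+ + 1) ≡ 0#
      raise-succ zero    = ≡.refl
      raise-succ (suc m) = ≡.refl
      raise-pred : ∀ k → raise v (-[1+ m ] ℤ.- + k) ≡ 0#
      raise-pred zero    = ≡.refl
      raise-pred (suc k) = ≡.refl

    w : ℕ → ℕ → A
    w j n = pow n (opW p a) (ê (+ j)) (+ 0)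

    w-first-passage : ∀ i → w (suc i) ≋ w 0 ⋆ delay (h 1 i)
    w-first-passage i n =
      trans (pow-cong W-linear n (ê-suc≋raise i) (+ 0))
            (duhamel-⋆₁ W-linear (λ t → raise (pow t (opH p a 1) (e i))) (h 1 i) (ê (+ 0))
                        (λ t → W-raise (pow t (opH p a 1) (e i))) (+ 0) (λ _ → refl) n)

    ψ-suc : ∀ i → ψ p a (suc i) ≈L ψ p a 0 *L φ p a 1 i
    ψ-suc i = resolvent-*L (w-first-passage i)

    w-step : ∀ n → w 0 (suc n) ≈ pow n (opW p a) (ê -[1+ 0 ]) (+ 0) + Σ< (suc p) (λ k → a k (+ 0) * w k n)
    w-step n = begin
      pow (suc n) (opW p a) (ê (+ 0)) (+ 0)     ≡⟨ ≡.cong (λ v → v (+ 0)) (pow-suc′ n (opW p a) (ê (+ 0))) ⟩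
      pow n (opW p a) (opW p a (ê (+ 0))) (+ 0) ≈⟨ pow-cong W-linear n W-ê₀ (+ 0) ⟩
      pow n (opW p a) (λ x → ê -[1+ 0 ] x + Σ< (suc p) (λ k → a k (+ 0) * ê (+ k) x)) (+ 0)
        ≈⟨ IsLinear.+-homo (pow-linear W-linear n) _ _ (+ 0) ⟩
      pow n (opW p a) (ê -[1+ 0 ]) (+ 0) + pow n (opW p a) (λ x → Σ< (suc p) (λ k → a k (+ 0) * ê (+ k) x)) (+ 0)
        ≈⟨ +-congˡ (linear-Σ<-scaled (pow-linear W-linear n) (suc p) _ _ (+ 0)) ⟩
      pow n (opW p a) (ê -[1+ 0 ]) (+ 0) + Σ< (suc p) (λ k → a k (+ 0) * w k n) ∎

    Σ<-ê-off : ∀ N (f : ℕ → A) m → N ≤ m → Σ< N (λ j → f j * ê (+ j) (+ m)) ≈ 0#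
    Σ<-ê-off zero    f m N≤m = refl
    Σ<-ê-off (suc N) f m N<m =
      trans (+-cong (Σ<-ê-off N f m (ℕ.<⇒≤ N<m)) (*-ê-off (f N) (λ N≡m → ℕ.<⇒≢ N<m (ℤ.+-injective N≡m))))
            (+-identityʳ 0#)

    Σ<-ê-diag : ∀ N (f : ℕ → A) m → m < N → Σ< N (λ j → f j * ê (+ j) (+ m)) ≈ f m
    Σ<-ê-diag (suc N) f m m<1+N with m ℕ.≟ N
    ... | yes ≡.refl = trans (+-cong (Σ<-ê-off N f N ℕ.≤-refl) (trans (*-congˡ (ê-diag (+ N))) (*-identityʳ _)))
                             (+-identityˡ _)
    ... | no  m≢N    = trans (+-cong (Σ<-ê-diag N f m (ℕ.≤∧≢⇒< (ℕ.≤-pred m<1+N) m≢N))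
                                     (*-ê-off (f N) (λ N≡m → m≢N (≡.sym (ℤ.+-injective N≡m)))))
                             (+-identityʳ _)

    B-e : ∀ i → opB p a 1 (e i) ≋ λ m → e i (suc m) + Σ< (suc p) (λ k → a k (-[1+ i ] ℤ.- + k) * e (k ℕ.+ i) m)
    B-e i m = +-congˡ (Σ<-cong (suc p) term)
      where
      term : ∀ k → (if k ℕ.≤ᵇ m then a k (ℤ.- + k ℤ.- + 1 ℤ.- + (m ∸ k)) * e i (m ∸ k) else 0#)
                 ≈ a k (-[1+ i ] ℤ.- + k) * e (k ℕ.+ i) m
      term k with k ℕ.≤? m
      ... | yes k≤m = trans (reflexive (≡.trans (if-≤ᵇ-yes k≤m) (≡.cong (_ *_) (e-∸ i k≤m))))
                            (*-e-cong (k ℕ.+ i) m (λ { ≡.refl → reflexive (≡.cong (a k)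
                              (≡.trans (≡.cong (λ d → ℤ.- + k ℤ.- + 1 ℤ.- + d) (ℕ.m+n∸m≡n k i))
                                       (≡.sym (-[1+i]-k≡-k-1-i i k)))) }))
      ... | no k≰m  = trans (reflexive (if-≤ᵇ-no k≰m))
                            (sym (*-e-off _ (λ k+i≡m → k≰m (ℕ.≤-trans (ℕ.m≤m+n k i) (ℕ.≤-reflexive k+i≡m)))))

    b : ℕ → ℕ → A
    b i n = pow n (opB p a 1) (e i) 0

    -- negB n stores b i n at the index -1-i of ℤ; W acts on it as B₁ does on the e_i,
    -- up to a leak into ê₀, …, ê_{p-1}.
    negB : ℕ → ℤ → A
    negB n (+ _)    = 0#
    negB n -[1+ i ] = b i n

    leak : ℕ → ℕ → A
    leak m n = Σ< (suc p) (λ k → a k (+ m ℤ.- + k) * negB n (+ m ℤ.- + k))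

    negB-suc : ∀ n i → negB (suc n) -[1+ i ] ≈
               negB n (-[1+ i ] ℤ.+ + 1) + Σ< (suc p) (λ k → a k (-[1+ i ] ℤ.- + k) * negB n (-[1+ i ] ℤ.- + k))
    negB-suc n i = begin
      pow (suc n) (opB p a 1) (e i) 0          ≡⟨ ≡.cong (λ v → v 0) (pow-suc′ n (opB p a 1) (e i)) ⟩
      pow n (opB p a 1) (opB p a 1 (e i)) 0    ≈⟨ pow-cong (B-linear 1) n (B-e i) 0 ⟩
      pow n (opB p a 1) (λ m → e i (suc m) + Σ< (suc p) (λ k → a k (-[1+ i ] ℤ.- + k) * e (k ℕ.+ i) m)) 0
        ≈⟨ IsLinear.+-homo Bⁿ _ _ 0 ⟩
      pow n (opB p a 1) (λ m → e i (suc m)) 0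
        + pow n (opB p a 1) (λ m → Σ< (suc p) (λ k → a k (-[1+ i ] ℤ.- + k) * e (k ℕ.+ i) m)) 0
        ≈⟨ +-cong (shifted i) (trans (linear-Σ<-scaled Bⁿ (suc p) _ _ 0)
                                     (Σ<-cong (suc p) (λ k → *-congˡ (reflexive (b-index k))))) ⟩
      negB n (-[1+ i ] ℤ.+ + 1) + Σ< (suc p) (λ k → a k (-[1+ i ] ℤ.- + k) * negB n (-[1+ i ] ℤ.- + k)) ∎
      where
      Bⁿ = pow-linear (B-linear 1) n
      shifted : ∀ i → pow n (opB p a 1) (λ m → e i (suc m)) 0 ≈ negB n (-[1+ i ] ℤ.+ + 1)
      shifted zero    = linear-0 Bⁿ 0
      shifted (suc i) = refl
      b-index : ∀ k → b (k ℕ.+ i) n ≡ negB n (-[1+ i ] ℤ.- + k)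
      b-index zero    = ≡.refl
      b-index (suc k) = ≡.cong (λ j → b (suc j) n) (ℕ.+-comm k i)

    leak-vanishes : ∀ m n → p ≤ m → leak m n ≈ 0#
    leak-vanishes m n p≤m = trans
      (Σ<-cong-< (suc p) {g = λ _ → 0#} (λ k k<1+p →
        trans (*-congˡ (reflexive (≡.cong (negB n) (+m-+n≡+[m∸n] (ℕ.≤-trans (ℕ.≤-pred k<1+p) p≤m)))))
              (zeroʳ _)))
      (Σ<-zero (suc p) (λ _ → refl))

    W-negB : ∀ n → opW p a (negB n) ≋ λ x → negB (suc n) x + Σ< p (λ m → leak m n * ê (+ m) x)
    W-negB n (+ m) with m ℕ.<? p
    ... | yes m<p = +-congˡ (sym (Σ<-ê-diag p (λ j → leak j n) m m<p))
    ... | no  m≮p = +-congˡ (trans (leak-vanishes m n (ℕ.≮⇒≥ m≮p))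
                                   (sym (Σ<-ê-off p (λ j → leak j n) m (ℕ.≮⇒≥ m≮p))))
    W-negB n -[1+ i ] =
      sym (trans (+-cong (negB-suc n i) (Σ<-zero p (λ m → *-ê-off _ {+ m} { -[1+ i ]} (λ ())))) (+-identityʳ _))

    ê₋₁≋negB₀ : ê -[1+ 0 ] ≋ negB 0
    ê₋₁≋negB₀ (+ m)        = ê-off { -[1+ 0 ]} {+ m} (λ ())
    ê₋₁≋negB₀ -[1+ zero ]  = ê-diag -[1+ 0 ]
    ê₋₁≋negB₀ -[1+ suc i ] = ê-off { -[1+ 0 ]} { -[1+ suc i ]} (λ ())

    w-from-ê₋₁ : ∀ n → pow n (opW p a) (ê -[1+ 0 ]) (+ 0) ≈ Σ< p (λ m → (w m ⋆ delay (leak m)) n)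
    w-from-ê₋₁ n = trans (pow-cong W-linear n ê₋₁≋negB₀ (+ 0))
                         (duhamel-⋆ W-linear negB p leak (λ m → ê (+ m)) W-negB (+ 0) (λ _ → refl) n)

    -- Only the terms k > m of leak m survive; with i = k - 1 and k' = k - m - 1 they form the
    -- double sum of the statement.
    leak-reindex : ∀ M → Σ< p (λ m → (w m ⋆ delay (leak m)) M)
                       ≈ Σ< p (λ i → Σ< (suc i) (λ k → a (suc i) -[1+ k ] * (w (i ∸ k) ⋆ delay (b k)) M))
    leak-reindex M = begin
      Σ< p (λ m → (w m ⋆ delay (leak m)) M)
        ≈⟨ Σ<-cong p (λ m → trans (⋆-congʳ (w m) (delay-Σ<-scaled (suc p) _ _) M)
                                  (⋆-Σ<-scaled (suc p) (w m) _ (λ k → delay (λ t → negB t (+ m ℤ.- + k))) M)) ⟩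
      Σ< p (λ m → Σ< (suc p) (λ k → G k m))
        ≈⟨ Σ<-comm p (suc p) _ ⟩
      Σ< (suc p) (λ k → Σ< p (λ m → G k m))
        ≈⟨ Σ<-suc p _ ⟩
      Σ< p (λ m → G 0 m) + Σ< p (λ i → Σ< p (λ m → G (suc i) m))
        ≈⟨ +-cong (Σ<-zero p (λ m → G-vanishes z≤n)) (Σ<-cong-< p G-column) ⟩
      0# + Σ< p (λ i → Σ< (suc i) (λ k → a (suc i) -[1+ k ] * (w (i ∸ k) ⋆ delay (b k)) M))
        ≈⟨ +-identityˡ _ ⟩
      Σ< p (λ i → Σ< (suc i) (λ k → a (suc i) -[1+ k ] * (w (i ∸ k) ⋆ delay (b k)) M)) ∎
      where
      G : ℕ → ℕ → A
      G k m = a k (+ m ℤ.- + k) * (w m ⋆ delay (λ t → negB t (+ m ℤ.- + k))) M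

      G-vanishes : ∀ {k m} → k ≤ m → G k m ≈ 0#
      G-vanishes {k} {m} k≤m = trans (*-congˡ (⋆-zeroʳ (w m) vanishes M)) (zeroʳ _)
        where
        vanishes : delay (λ t → negB t (+ m ℤ.- + k)) ≋ λ _ → 0#
        vanishes zero    = refl
        vanishes (suc t) = reflexive (≡.cong (negB t) (+m-+n≡+[m∸n] k≤m))

      G-column : ∀ i → i < p → Σ< p (λ m → G (suc i) m)
                             ≈ Σ< (suc i) (λ k → a (suc i) -[1+ k ] * (w (i ∸ k) ⋆ delay (b k)) M)
      G-column i i<p = begin
        Σ< p (λ m → G (suc i) m)             ≈⟨ Σ<-truncate _ i<p (λ m → G-vanishes) ⟩
        Σ< (suc i) (λ m → G (suc i) m)       ≈⟨ Σ<-reverse i _ ⟨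
        Σ< (suc i) (λ k → G (suc i) (i ∸ k))
          ≈⟨ Σ<-cong-< (suc i) (λ k k<1+i → reflexive
               (≡.cong (λ d → a (suc i) d * (w (i ∸ k) ⋆ delay (λ t → negB t d)) M)
                       ([i∸k]-[1+i]≡-[1+k] (ℕ.≤-pred k<1+i)))) ⟩
        Σ< (suc i) (λ k → a (suc i) -[1+ k ] * (w (i ∸ k) ⋆ delay (b k)) M) ∎

    w₀⋆φ↑ : ∀ j → w 0 ⋆ cf (φ↑ p a 1 j) ≋ w j
    w₀⋆φ↑ zero    n = trans (⋆-const 1# (w 0) n) (*-identityˡ _)
    w₀⋆φ↑ (suc i) n = sym (w-first-passage i n)

    term : ℕ → ℕ → Laurent
    term i k = const (a (suc i) (ℤ.- + k)) *L φ↑ p a 1 (suc i ∸ k) *L β↑ p a 1 k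

    top-term : ∀ i k → top (term i k) ≡ 0
    top-term i k = ≡.cong₂ ℕ._+_ (top-φ↑ (suc i ∸ k)) (top-β↑ k)
      where
      top-φ↑ : ∀ j → top (φ↑ p a 1 j) ≡ 0
      top-φ↑ zero    = ≡.refl
      top-φ↑ (suc j) = ≡.refl
      top-β↑ : ∀ j → top (β↑ p a 1 j) ≡ 0
      top-β↑ zero    = ≡.refl
      top-β↑ (suc j) = ≡.refl

    S₂ : Laurent
    S₂ = ΣL< p (λ i → ΣL< (suc (suc i)) (term i))

    top-S₂ : top S₂ ≡ 0
    top-S₂ = top-ΣL< p _ (λ i → top-ΣL< (suc (suc i)) (term i) (top-term i))

    w₀⋆term : ∀ i k M → (w 0 ⋆ cf (term i k)) M ≈ a (suc i) (ℤ.- + k) * (w (suc i ∸ k) ⋆ cf (β↑ p a 1 k)) M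
    w₀⋆term i k M = begin
      (w 0 ⋆ ((cf (const α) ⋆ f) ⋆ g)) M
        ≈⟨ ⋆-congʳ (w 0) (λ N → trans (⋆-congˡ g (const-⋆ α f) N) (⋆-scaleˡ α f g N)) M ⟩
      (w 0 ⋆ (λ N → α * (f ⋆ g) N)) M    ≈⟨ ⋆-scaleʳ α (w 0) (f ⋆ g) M ⟩
      α * (w 0 ⋆ (f ⋆ g)) M              ≈⟨ *-congˡ (⋆-assoc (w 0) f g M) ⟨
      α * ((w 0 ⋆ f) ⋆ g) M              ≈⟨ *-congˡ (⋆-congˡ g (w₀⋆φ↑ (suc i ∸ k)) M) ⟩
      α * (w (suc i ∸ k) ⋆ g) M          ∎
      where
      α : A
      α = a (suc i) (ℤ.- + k)
      f g : ℕ → A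
      f = cf (φ↑ p a 1 (suc i ∸ k))
      g = cf (β↑ p a 1 k)

    w₀⋆S₂ : ∀ M → (w 0 ⋆ cf S₂) M
                  ≈ Σ< p (λ i → a (suc i) (+ 0) * w (suc i) M)
                    + Σ< p (λ i → Σ< (suc i) (λ k → a (suc i) -[1+ k ] * (w (i ∸ k) ⋆ delay (b k)) M))
    w₀⋆S₂ M = begin
      (w 0 ⋆ cf S₂) M
        ≈⟨ ⋆-congʳ (w 0) (λ N → trans (cf-ΣL< p (λ i → ΣL< (suc (suc i)) (term i)) (λ i → top-ΣL< (suc (suc i)) (term i) (top-term i)) N)
                                       (Σ<-cong p (λ i → cf-ΣL< (suc (suc i)) (term i) (top-term i) N))) M ⟩
      (w 0 ⋆ (λ N → Σ< p (λ i → Σ< (suc (suc i)) (λ k → cf (term i k) N)))) M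
        ≈⟨ ⋆-distribˡ-Σ< p (w 0) (λ i N → Σ< (suc (suc i)) (λ k → cf (term i k) N)) M ⟩
      Σ< p (λ i → (w 0 ⋆ (λ N → Σ< (suc (suc i)) (λ k → cf (term i k) N))) M)
        ≈⟨ Σ<-cong p (λ i → trans (⋆-distribˡ-Σ< (suc (suc i)) (w 0) (λ k → cf (term i k)) M) (Σ<-suc (suc i) _)) ⟩
      Σ< p (λ i → (w 0 ⋆ cf (term i 0)) M + Σ< (suc i) (λ k → (w 0 ⋆ cf (term i (suc k))) M))
        ≈⟨ Σ<-cong p (λ i → +-cong (trans (w₀⋆term i 0 M) (*-congˡ (trans (⋆-const 1# _ M) (*-identityˡ _))))
                                   (Σ<-cong (suc i) (λ k → w₀⋆term i (suc k) M))) ⟩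
      Σ< p (λ i → a (suc i) (+ 0) * w (suc i) M
                  + Σ< (suc i) (λ k → a (suc i) -[1+ k ] * (w (i ∸ k) ⋆ delay (b k)) M))
        ≈⟨ Σ<-distrib-+ p _ _ ⟩
      Σ< p (λ i → a (suc i) (+ 0) * w (suc i) M)
        + Σ< p (λ i → Σ< (suc i) (λ k → a (suc i) -[1+ k ] * (w (i ∸ k) ⋆ delay (b k)) M)) ∎

    ψ₀-inverse : ψ p a 0 *L (zL -L const (a 0 (+ 0)) -L S₂) ≈L oneL
    ψ₀-inverse = resolvent-inverse top-S₂ (ê-diag (+ 0)) recurrence
      where
      recurrence : ∀ M → w 0 (suc M) ≈ a 0 (+ 0) * w 0 M + (w 0 ⋆ cf S₂) M
      recurrence M = begin
        w 0 (suc M)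
          ≈⟨ w-step M ⟩
        pow M (opW p a) (ê -[1+ 0 ]) (+ 0) + Σ< (suc p) (λ k → a k (+ 0) * w k M)
          ≈⟨ +-cong (trans (w-from-ê₋₁ M) (leak-reindex M)) (Σ<-suc p _) ⟩
        Q + (a 0 (+ 0) * w 0 M + P)
          ≈⟨ +-comm _ _ ⟩
        a 0 (+ 0) * w 0 M + P + Q
          ≈⟨ +-assoc _ _ _ ⟩
        a 0 (+ 0) * w 0 M + (P + Q)
          ≈⟨ +-congˡ (w₀⋆S₂ M) ⟨
        a 0 (+ 0) * w 0 M + (w 0 ⋆ cf S₂) M ∎
        where
        P = Σ< p (λ i → a (suc i) (+ 0) * w (suc i) M)
        Q = Σ< p (λ i → Σ< (suc i) (λ k → a (suc i) -[1+ k ] * (w (i ∸ k) ⋆ delay (b k)) M))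

open import Data.Integer using (-_)

-- The identities hold for every p.
corollary4p2 : ∀ {c ℓ : Level} (R : CommutativeRing c ℓ) →
    let open CommutativeRing R using (Carrier) in
    let open Series R in
    (p : ℕ) → 1 ≤ p → (a : ℕ → ℤ → Carrier) →
    (∀ (k : ℕ) →
      φ p a k 0 *L
        (zL -L const (a 0 (+ k))
            -L ΣL< p (λ i → const (a (suc i) (+ k)) *L φ p a (suc k) i))
      ≈L oneL)
    × (∀ (k j : ℕ) → 1 ≤ j → j ≤ p →
      φ p a k j ≈L φ p a k 0 *L φ p a (suc k) (j ∸ 1))
    × (ψ p a 0 *L
        (zL -L const (a 0 (+ 0))
            -L ΣL< p (λ i → ΣL< (suc (suc i)) (λ k →
                 const (a (suc i) (- (+ k))) *L φ↑ p a 1 (suc i ∸ k) *L β↑ p a 1 k)))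
      ≈L oneL)
    × (∀ (j : ℕ) → 1 ≤ j → j ≤ p →
      ψ p a j ≈L ψ p a 0 *L φ p a 1 (j ∸ 1))
corollary4p2 R p _ a =
    φ₀-inverse
  , (λ { k (suc i) _ _ → φ-suc k i })
  , ψ₀-inverse
  , (λ { (suc i) _ _ → ψ-suc i })
  where
  open ResolventIdentities R
  open Operators p a
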